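{- Let $p$ be a prime and $m \in \mathbb{F}_p$. The fundamental block $F(p,m) = (a_{i,j})_{0\le i,j\le p-1}$ contains a zero if and only if $m \neq -1$. In this case the row $i = 1$ contains exactly one zero, namely for $0 \le k \le p-1$: $a_{1,k} = 0$ if and only if $k = -(m+1)^{ -1}$ in $\mathbb{F}_p$.
   Context: $F(p,m) = (a_{i,j})_{0 \le i,j \le p-1}$ is the $p\times p$ matrix over $\mathbb{F}_p$ with $a_{i,0} = a_{0,j} = 1$ and $a_{i,j} = a_{i-1,j} + m\, a_{i-1,j-1} + a_{i,j-1}$ for $i,j \geq 1$. The index $k$ is identified with its residue in $\mathbb{F}_p$. -}

module Defs where

open import Data.Nat using (ℕ; zero; suc; _+_; _*_; _%_; NonZero)
open import Data.Fin using (Fin; toℕ)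
open import Relation.Binary.PropositionalEquality using (_≡_)

-- Elements of 𝔽_p are represented by Fin p (residues 0..p-1); arithmetic
-- is ℕ arithmetic reduced mod p.

entry : (p : ℕ) → .{{_ : NonZero p}} → ℕ → ℕ → ℕ → ℕ
entry p m zero    j       = 1 % p
entry p m (suc i) zero    = 1 % p
entry p m (suc i) (suc j) =
  (entry p m i (suc j) + m * entry p m i j + entry p m (suc i) j) % p

F : (p : ℕ) → .{{_ : NonZero p}} → Fin p → Fin p → Fin p → ℕ
F p m i j = entry p (toℕ m) (toℕ i) (toℕ j)

-- x ≡ -(y)⁻¹ in 𝔽_p  ⟺  x * y = -1, i.e. x * y + 1 ≡ 0 (mod p)
IsNegInv : (p : ℕ) → .{{_ : NonZero p}} → ℕ → ℕ → Set
IsNegInv p x y = (x * y + 1) % p ≡ 0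

{-# OPTIONS --safe #-}
module Submission where

-- Row 0 is constantly 1, so row 1 satisfies a_{1,k} = a_{1,k-1} + (m + 1) and
-- a_{1,k} = 1 + k (m + 1); it vanishes exactly at k = -(m + 1)⁻¹, which exists
-- in 𝔽_p iff m ≠ -1. Conversely, when m = -1 the recurrence reads
-- a_{i,j} = a_{i-1,j} - a_{i-1,j-1} + a_{i,j-1}, which keeps every entry equal to 1.

open import Defs
open import Data.Nat using (ℕ; zero; suc; _+_; _*_; _∸_; _%_; _<_; s≤s; s≤s⁻¹; z<s; NonZero; >-nonZero; nonTrivial⇒n>1)
open import Data.Nat.Properties using (+-comm; *-assoc; ≤∧≢⇒<; 0≢1+n)
open import Data.Nat.DivMod using (%-distribˡ-+; %-distribˡ-*; m%n%n≡m%n; m%n<n; m*n%n≡0; n%n≡0; m<n⇒m%n≡m)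
open import Data.Nat.Primality using (Prime; prime⇒nonTrivial)
open import Data.Nat.Coprimality using (prime⇒coprime; coprime-Bézout)
open import Data.Nat.GCD using (module Bézout)
open import Data.Nat.Solver using (module +-*-Solver)
open import Data.Fin using (Fin; toℕ; fromℕ<)
open import Data.Fin.Properties using (toℕ<n; toℕ-fromℕ<)
open import Data.Product using (_×_; ∃-syntax; _,_)
open import Function.Bundles using (_⇔_; mk⇔)
open import Relation.Binary.PropositionalEquality
open import Relation.Nullary using (¬_)

open +-*-Solver using (solve; _:+_; _:*_; _:=_; con)
open ≡-Reasoning

module _ (d : ℕ) .{{_ : NonZero d}} where

  %-cong-+ : ∀ {a a′ b b′} → a % d ≡ a′ % d → b % d ≡ b′ % d → (a + b) % d ≡ (a′ + b′) % d
  %-cong-+ {a} {a′} {b} {b′} a≡a′ b≡b′ = begin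
    (a + b) % d           ≡⟨ %-distribˡ-+ a b d ⟩
    (a % d + b % d) % d   ≡⟨ cong₂ (λ x y → (x + y) % d) a≡a′ b≡b′ ⟩
    (a′ % d + b′ % d) % d ≡⟨ %-distribˡ-+ a′ b′ d ⟨
    (a′ + b′) % d         ∎

  %-cong-* : ∀ {a a′ b b′} → a % d ≡ a′ % d → b % d ≡ b′ % d → (a * b) % d ≡ (a′ * b′) % d
  %-cong-* {a} {a′} {b} {b′} a≡a′ b≡b′ = begin
    (a * b) % d           ≡⟨ %-distribˡ-* a b d ⟩
    (a % d * (b % d)) % d ≡⟨ cong₂ (λ x y → (x * y) % d) a≡a′ b≡b′ ⟩
    (a′ % d * (b′ % d)) % d ≡⟨ %-distribˡ-* a′ b′ d ⟨
    (a′ * b′) % d         ∎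

  %-reduce : ∀ {x} a → x ≡ a % d → x % d ≡ a % d
  %-reduce a refl = m%n%n≡m%n a d

module _ (p : ℕ) .{{_ : NonZero p}} (m : ℕ) where

  entry-suc-suc : ∀ i j a b c →
    entry p m i (suc j) ≡ a % p → entry p m i j ≡ b % p → entry p m (suc i) j ≡ c % p →
    entry p m (suc i) (suc j) ≡ (a + m * b + c) % p
  entry-suc-suc i j a b c aᵢ,ⱼ₊₁ aᵢ,ⱼ aᵢ₊₁,ⱼ =
    %-cong-+ p (%-cong-+ p (%-reduce p a aᵢ,ⱼ₊₁) (%-cong-* p {m} refl (%-reduce p b aᵢ,ⱼ)))
               (%-reduce p c aᵢ₊₁,ⱼ)

  entry-row₁ : ∀ k → entry p m 1 k ≡ (k * (m + 1) + 1) % p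
  entry-row₁ zero    = refl
  entry-row₁ (suc k) = begin
    entry p m 1 (suc k)                 ≡⟨ entry-suc-suc 0 k 1 1 (k * (m + 1) + 1) refl refl (entry-row₁ k) ⟩
    (1 + m * 1 + (k * (m + 1) + 1)) % p ≡⟨ cong (_% p) (row₁-step m k) ⟩
    (suc k * (m + 1) + 1) % p           ∎
    where
    row₁-step : ∀ m k → 1 + m * 1 + (k * (m + 1) + 1) ≡ suc k * (m + 1) + 1
    row₁-step = solve 2 (λ m k → con 1 :+ m :* con 1 :+ (k :* (m :+ con 1) :+ con 1)
                              := (con 1 :+ k) :* (m :+ con 1) :+ con 1) refl

  entry-row₁≡0⇔IsNegInv : ∀ k → (entry p m 1 k ≡ 0) ⇔ IsNegInv p k (m + 1)
  entry-row₁≡0⇔IsNegInv k = mk⇔ (trans (sym (entry-row₁ k))) (trans (entry-row₁ k))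

  m≡-1⇒entry≡1 : (m + 1) % p ≡ 0 → ∀ i j → entry p m i j ≡ 1 % p
  m≡-1⇒entry≡1 m≡-1 zero    j       = refl
  m≡-1⇒entry≡1 m≡-1 (suc i) zero    = refl
  m≡-1⇒entry≡1 m≡-1 (suc i) (suc j) = begin
    entry p m (suc i) (suc j) ≡⟨ entry-suc-suc i j 1 1 1 (m≡-1⇒entry≡1 m≡-1 i (suc j))
                                   (m≡-1⇒entry≡1 m≡-1 i j) (m≡-1⇒entry≡1 m≡-1 (suc i) j) ⟩
    (1 + m * 1 + 1) % p       ≡⟨ cong (_% p) (regroup m) ⟩
    -- 0 % p is stuck for a variable p; m*n%n≡0 0 p is the equation 0 % p ≡ 0.
    (1 + (m + 1)) % p         ≡⟨ %-cong-+ p refl (trans m≡-1 (sym (m*n%n≡0 0 p))) ⟩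
    1 % p                     ∎
    where
    regroup : ∀ m → 1 + m * 1 + 1 ≡ 1 + (m + 1)
    regroup = solve 1 (λ m → con 1 :+ m :* con 1 :+ con 1 := con 1 :+ (m :+ con 1)) refl

IsNegInv-% : ∀ p .{{_ : NonZero p}} {k a} → IsNegInv p k a → IsNegInv p (k % p) a
IsNegInv-% p {k} k⁻ = trans (%-cong-+ p (%-cong-* p (m%n%n≡m%n k p) refl) refl) k⁻

-- Bézout gives 1 + y a = x p or 1 + x p = y a; in the second case -y = (p - 1) y works.
IsNegInv-exists : ∀ p .{{_ : NonZero p}} {a} → Bézout.Identity 1 p a → ∃[ k ] IsNegInv p k a
IsNegInv-exists p {a} (Bézout.+- x y 1+ya≡xp) = y , (begin
  (y * a + 1) % p ≡⟨ cong (_% p) (trans (+-comm (y * a) 1) 1+ya≡xp) ⟩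
  (x * p) % p     ≡⟨ m*n%n≡0 x p ⟩
  0               ∎)
IsNegInv-exists (suc q) {a} (Bézout.-+ x y 1+xp≡ya) = q * y , (begin
  (q * y * a + 1) % p       ≡⟨ cong (_% p) (negate q x y a 1+xp≡ya) ⟩
  ((1 + q * x) * p) % p     ≡⟨ m*n%n≡0 (1 + q * x) p ⟩
  0                         ∎)
  where
  p = suc q
  negate : ∀ q x y a → 1 + x * suc q ≡ y * a → q * y * a + 1 ≡ (1 + q * x) * suc q
  negate q x y a 1+xp≡ya = begin
    q * y * a + 1             ≡⟨ cong (_+ 1) (*-assoc q y a) ⟩
    q * (y * a) + 1           ≡⟨ cong (λ z → q * z + 1) 1+xp≡ya ⟨
    q * (1 + x * suc q) + 1   ≡⟨ solve 2 (λ q x → q :* (con 1 :+ x :* (con 1 :+ q)) :+ con 1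
                                                := (con 1 :+ q :* x) :* (con 1 :+ q)) refl q x ⟩
    (1 + q * x) * suc q       ∎

IsNegInv-exists-< : ∀ p .{{_ : NonZero p}} {a} → Prime p → .{{NonZero a}} → a < p →
  ∃[ k ] k < p × IsNegInv p k a
IsNegInv-exists-< p p-prime a<p with IsNegInv-exists p (coprime-Bézout (prime⇒coprime p-prime a<p))
... | k , k⁻ = k % p , m%n<n k p , IsNegInv-% p k⁻

lemma3p9 : (p : ℕ) → .{{_ : NonZero p}} → Prime p → (m : Fin p) →
    ((∃[ i ] ∃[ j ] F p m i j ≡ 0) ⇔ (¬ toℕ m ≡ p ∸ 1))
    × (¬ toℕ m ≡ p ∸ 1 →
        (k : Fin p) → ((entry p (toℕ m) 1 (toℕ k) ≡ 0) ⇔ IsNegInv p (toℕ k) (toℕ m + 1)))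
lemma3p9 p@(suc q) p-prime m =
  mk⇔ zero⇒m≢-1 m≢-1⇒zero , λ _ k → entry-row₁≡0⇔IsNegInv p (toℕ m) (toℕ k)
  where
  1<p : 1 < p
  1<p = nonTrivial⇒n>1 p {{prime⇒nonTrivial p-prime}}

  zero⇒m≢-1 : (∃[ i ] ∃[ j ] F p m i j ≡ 0) → ¬ toℕ m ≡ q
  zero⇒m≢-1 (i , j , aᵢⱼ≡0) m≡q = 0≢1+n (begin
    0                                 ≡⟨ aᵢⱼ≡0 ⟨
    entry p (toℕ m) (toℕ i) (toℕ j)   ≡⟨ m≡-1⇒entry≡1 p (toℕ m) m+1%p≡0 (toℕ i) (toℕ j) ⟩
    1 % p                             ≡⟨ m<n⇒m%n≡m 1<p ⟩
    1                                 ∎)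
    where
    m+1%p≡0 : (toℕ m + 1) % p ≡ 0
    m+1%p≡0 = trans (cong (_% p) (trans (cong (_+ 1) m≡q) (+-comm q 1))) (n%n≡0 p)

  m≢-1⇒zero : ¬ toℕ m ≡ q → ∃[ i ] ∃[ j ] F p m i j ≡ 0
  m≢-1⇒zero m≢q with IsNegInv-exists-< p p-prime {{>-nonZero m+1>0}} m+1<p
    where
    m+1>0 : 0 < toℕ m + 1
    m+1>0 = subst (0 <_) (+-comm 1 (toℕ m)) z<s
    m+1<p : toℕ m + 1 < p
    m+1<p = subst (_< p) (+-comm 1 (toℕ m)) (s≤s (≤∧≢⇒< (s≤s⁻¹ (toℕ<n m)) m≢q))
  ... | k , k<p , k⁻ = fromℕ< 1<p , fromℕ< k<p ,
    subst₂ (λ i j → entry p (toℕ m) i j ≡ 0) (sym (toℕ-fromℕ< 1<p)) (sym (toℕ-fromℕ< k<p))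
      (trans (entry-row₁ p (toℕ m) k) k⁻)
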